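{- There is no infinite arithmetic progression in $\mathbb Q$ all of whose elements have infinite order: for any $u\in\mathbb Q$ and any $r\in\mathbb Q\setminus\{0\}$, there exists $n\in\mathbb N$ such that $\mathrm{ord}(u+nr)<\infty$.
   Context: Let $\chi:\mathbb Q\to\mathbb Q$ be defined by $\chi(x)=x\lceil x\rceil$, where $\lceil x\rceil$ is the smallest integer greater than or equal to $x$. For $x\in\mathbb Q$, $\mathrm{ord}(x)=\min\{k\in\mathbb N_0:\chi^k(x)\in\mathbb Z\}$ if this set is nonempty, and $\mathrm{ord}(x)=\infty$ otherwise ($\mathbb N=\{1,2,\dots\}$, $\mathbb N_0=\mathbb N\cup\{0\}$). -}

module Defs where

open import Data.Nat using (ℕ; zero; suc)
open import Data.Integer using (ℤ)
open import Data.Product using (Σ; ∃)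
open import Relation.Binary.PropositionalEquality using (_≡_)
open import Data.Rational using (ℚ; _*_; _/_; ceiling)

χ : ℚ → ℚ
χ x = x * (ceiling x / 1)

χ^ : ℕ → ℚ → ℚ
χ^ zero x = x
χ^ (suc k) x = χ (χ^ k x)

IsInt : ℚ → Set
IsInt x = ∃ λ (z : ℤ) → x ≡ z / 1

FiniteOrd : ℚ → Set
FiniteOrd x = ∃ λ (k : ℕ) → IsInt (χ^ k x)

module Submission where

open import Defs

-- Write u = y/D with D = e+1.  For integers z one has ⌈z/D⌉ = z ⌈/ℕ⌉ D, so
-- χ(z/D) = T(z)/D with T(z) = z·⌈z/D⌉, and z/D has finite order as soon as
-- D divides some iterate Tᵏ(z).  Writing r = p/(q+1) and taking m+1 = (q+1)·n,
-- the term u + (m+1)·r equals (y + D·p·n)/D, so it suffices to find n > 0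
-- with D ∣ Tᵏ(y + D·p·n) for some k.

module IntegerDynamics where

  open import Data.Nat as ℕ using (ℕ; zero; suc; NonZero; z≤n; s≤s)
  import Data.Nat.Properties as ℕ
  open import Data.Nat.Divisibility using (divides; 0∣⇒≡0)
  open import Data.Nat.GCD using (module Bézout; module GCD)
  open import Data.Nat.Induction using (<-rec)
  open import Data.Integer as ℤ
    using (ℤ; +_; -[1+_]; _+_; _*_; -_; _-_; _^_; _≤_; _<_; _/ℕ_)
  open import Data.Integer.Properties
  open import Data.Integer.DivMod using ([n/ℕd]*d≤n; n<s[n/ℕd]*d)
  open import Data.Integer.Divisibility.Signed using (_∣_; divides; ∣m∣n⇒∣m+n)
  open import Data.Integer.Tactic.RingSolver using (solve-∀)
  open import Data.Empty using (⊥; ⊥-elim)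
  open import Data.Product using (∃; ∃₂; _,_; proj₂)
  open import Relation.Binary using (tri<; tri≈; tri>)
  open import Relation.Binary.PropositionalEquality
  open ≡-Reasoning

  module FloorDivision {d : ℕ} .{{_ : NonZero d}} where

    /ℕ-upper : ∀ w → w < (w /ℕ d) * + d + + d
    /ℕ-upper w = subst (w <_) (trans (suc-* (w /ℕ d) (+ d)) (+-comm (+ d) ((w /ℕ d) * + d)))
                   (n<s[n/ℕd]*d w d)

    quotient-gap : ∀ {a b w} → a < b → w < a * + d + + d → b * + d ≤ w → ⊥
    quotient-gap {a} {b} a<b w<ad+d bd≤w =
      <-irrefl refl (<-≤-trans w<ad+d (≤-trans ad+d≤bd bd≤w))
      where
      ad+d≤bd : a * + d + + d ≤ b * + d
      ad+d≤bd = subst (_≤ b * + d) (trans (suc-* a (+ d)) (+-comm (+ d) (a * + d)))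
                  (*-monoʳ-≤-nonNeg (+ d) (i<j⇒suc[i]≤j a<b))

    /ℕ-unique : ∀ {a w} → a * + d ≤ w → w < a * + d + + d → w /ℕ d ≡ a
    /ℕ-unique {a} {w} lower upper with <-cmp (w /ℕ d) a
    ... | tri< q<a _ _ = ⊥-elim (quotient-gap q<a (/ℕ-upper w) lower)
    ... | tri≈ _ q≡a _ = q≡a
    ... | tri> _ _ a<q = ⊥-elim (quotient-gap a<q upper ([n/ℕd]*d≤n w d))

    /ℕ-shift : ∀ w j → (w + + d * j) /ℕ d ≡ w /ℕ d + j
    /ℕ-shift w j = /ℕ-unique
      (subst (_≤ w + + d * j) (sym (distrib q j (+ d))) (+-monoˡ-≤ (+ d * j) ([n/ℕd]*d≤n w d)))
      (subst (w + + d * j <_) (sym (distrib-upper q j (+ d))) (+-monoˡ-< (+ d * j) (/ℕ-upper w)))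
      where
      q = w /ℕ d
      distrib : ∀ q j D → (q + j) * D ≡ q * D + D * j
      distrib = solve-∀
      distrib-upper : ∀ q j D → (q + j) * D + D ≡ q * D + D + D * j
      distrib-upper = solve-∀

  open FloorDivision using (/ℕ-unique; /ℕ-upper; /ℕ-shift)

  /ℕ-scale : ∀ g w {d d′} .{{_ : NonZero d}} .{{_ : NonZero d′}} →
             + d ≡ + suc g * + d′ → (+ suc g * w) /ℕ d ≡ w /ℕ d′
  /ℕ-scale g w {d} {d′} d≡gd′ = /ℕ-unique
    (subst (_≤ G * w) lower (*-monoˡ-≤-nonNeg G ([n/ℕd]*d≤n w d′)))
    (subst (G * w <_) upper (*-monoˡ-<-pos G (/ℕ-upper w)))
    where
    G = + suc g
    q = w /ℕ d′
    lower : G * (q * + d′) ≡ q * + d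
    lower = trans (regroup G q (+ d′)) (cong (q *_) (sym d≡gd′))
      where
      regroup : ∀ G q D′ → G * (q * D′) ≡ q * (G * D′)
      regroup = solve-∀
    upper : G * (q * + d′ + + d′) ≡ q * + d + + d
    upper = trans (regroup G q (+ d′)) (cong (λ D → q * D + D) (sym d≡gd′))
      where
      regroup : ∀ G q D′ → G * (q * D′ + D′) ≡ q * (G * D′) + G * D′
      regroup = solve-∀

  /ℕ-cross : ∀ {n w d e} → n * + suc e ≡ w * + suc d → n /ℕ suc d ≡ w /ℕ suc e
  /ℕ-cross {n} {w} {d} {e} cross = begin
    n /ℕ suc d                                ≡⟨ /ℕ-scale e n (pos-* (suc e) (suc d)) ⟨
    (+ suc e * n) /ℕ (suc e ℕ.* suc d)        ≡⟨ cong (_/ℕ (suc e ℕ.* suc d)) swapped ⟩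
    (+ suc d * w) /ℕ (suc e ℕ.* suc d)        ≡⟨ /ℕ-scale d w (trans (pos-* (suc e) (suc d)) (*-comm (+ suc e) (+ suc d))) ⟩
    w /ℕ suc e                                ∎
    where
    swapped : + suc e * n ≡ + suc d * w
    swapped = trans (*-comm (+ suc e) n) (trans cross (*-comm w (+ suc d)))

  -- Ceiling division ⌈z / d⌉ = -⌊-z / d⌋; this is how ℚ's ceiling is computed.
  infixl 7 _⌈/ℕ⌉_
  _⌈/ℕ⌉_ : ℤ → (d : ℕ) → .{{_ : NonZero d}} → ℤ
  z ⌈/ℕ⌉ d = - ((- z) /ℕ d)

  ⌈⌉-shift : ∀ {d} .{{_ : NonZero d}} z j → (z + + d * j) ⌈/ℕ⌉ d ≡ z ⌈/ℕ⌉ d + j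
  ⌈⌉-shift {d} z j = begin
    - ((- (z + + d * j)) /ℕ d)        ≡⟨ cong (λ x → - (x /ℕ d)) (negate z (+ d) j) ⟩
    - ((- z + + d * - j) /ℕ d)        ≡⟨ cong -_ (/ℕ-shift (- z) (- j)) ⟩
    - ((- z) /ℕ d + - j)              ≡⟨ negate-sum ((- z) /ℕ d) j ⟩
    z ⌈/ℕ⌉ d + j                      ∎
    where
    negate : ∀ z D j → - (z + D * j) ≡ - z + D * - j
    negate = solve-∀
    negate-sum : ∀ q j → - (q + - j) ≡ - q + j
    negate-sum = solve-∀

  ⌈⌉-scale : ∀ g z {d d′} .{{_ : NonZero d}} .{{_ : NonZero d′}} →
             + d ≡ + suc g * + d′ → (+ suc g * z) ⌈/ℕ⌉ d ≡ z ⌈/ℕ⌉ d′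
  ⌈⌉-scale g z {d} d≡gd′ =
    cong -_ (trans (cong (_/ℕ d) (neg-distribʳ-* (+ suc g) z)) (/ℕ-scale g (- z) d≡gd′))

  -- The numerator map: for D = e+1, χ(z/D) = T e z / D (proved in RationalBridge).
  T : ℕ → ℤ → ℤ
  T e z = z * (z ⌈/ℕ⌉ suc e)

  Tᵏ : ℕ → ℕ → ℤ → ℤ
  Tᵏ e zero    z = z
  Tᵏ e (suc k) z = Tᵏ e k (T e z)

  T-shift : ∀ e y x →
            T e (y + + suc e * x) ≡ T e y + x * (y + + suc e * (y ⌈/ℕ⌉ suc e + x))
  T-shift e y x = begin
    (y + D * x) * ((y + D * x) ⌈/ℕ⌉ suc e)  ≡⟨ cong ((y + D * x) *_) (⌈⌉-shift y x) ⟩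
    (y + D * x) * (c + x)                   ≡⟨ expand y D x c ⟩
    y * c + x * (y + D * (c + x))           ∎
    where
    D = + suc e
    c = y ⌈/ℕ⌉ suc e
    expand : ∀ y D x c → (y + D * x) * (c + x) ≡ y * c + x * (y + D * (c + x))
    expand = solve-∀

  Tᵏ-scale : ∀ g {e e′} → + suc e ≡ + suc g * + suc e′ →
             ∀ k z → Tᵏ e k (+ suc g * z) ≡ + suc g * Tᵏ e′ k z
  Tᵏ-scale g eq zero    z = refl
  Tᵏ-scale g eq (suc k) z = trans (cong (Tᵏ _ k) T-scale) (Tᵏ-scale g eq k (T _ z))
    where
    T-scale : + suc g * z * ((+ suc g * z) ⌈/ℕ⌉ _) ≡ + suc g * (z * (z ⌈/ℕ⌉ _))
    T-scale = trans (cong (+ suc g * z *_) (⌈⌉-scale g z eq)) (*-assoc (+ suc g) z _)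

  T-congruence : ∀ e M {a b} → + suc e * M ∣ a - b → M ∣ T e a - T e b
  T-congruence e M {a} {b} (divides j a-b≡jDM) = divides (j * R) (begin
    T e a - T e b                   ≡⟨ cong (λ a → T e a - T e b) a≡b+Dx ⟩
    T e (b + D * x) - T e b         ≡⟨ cong (_- T e b) (T-shift e b x) ⟩
    T e b + j * M * R - T e b       ≡⟨ cancel (T e b) j M R ⟩
    j * R * M                       ∎)
    where
    D = + suc e
    x = j * M
    R = b + D * (b ⌈/ℕ⌉ suc e + x)
    a≡b+Dx : a ≡ b + D * x
    a≡b+Dx = trans (split a b) (trans (cong (λ t → b + t) a-b≡jDM) (regroup b j D M))
      where
      split : ∀ a b → a ≡ b + (a - b)
      split = solve-∀
      regroup : ∀ b j D M → b + j * (D * M) ≡ b + D * (j * M)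
      regroup = solve-∀
    cancel : ∀ t j M R → t + j * M * R - t ≡ j * R * M
    cancel = solve-∀

  Tᵏ-congruence : ∀ e k M {a b} → (+ suc e) ^ k * M ∣ a - b → M ∣ Tᵏ e k a - Tᵏ e k b
  Tᵏ-congruence e zero    M {a} {b} h = subst (_∣ a - b) (*-identityˡ M) h
  Tᵏ-congruence e (suc k) M {a} {b} h = Tᵏ-congruence e k M
    (T-congruence e ((+ suc e) ^ k * M) {a} {b} (subst (_∣ a - b) (*-assoc (+ suc e) ((+ suc e) ^ k) M) h))

  ∣-transfer : ∀ {M a b} → M ∣ a - b → M ∣ b → M ∣ a
  ∣-transfer {M} {a} {b} M∣a-b M∣b = subst (M ∣_) (telescope a b) (∣m∣n⇒∣m+n M∣a-b M∣b)
    where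
    telescope : ∀ a b → a - b + b ≡ a
    telescope = solve-∀

  unit-complement : ∀ {u v D w} → u * v + D * w ≡ + 1 → + 1 - u * v ≡ D * w
  unit-complement {u} {v} {D} {w} uv+Dw≡1 =
    trans (cong (_- u * v) (sym uv+Dw≡1)) (cancel (u * v) (D * w))
    where
    cancel : ∀ a b → a + b - a ≡ b
    cancel = solve-∀

  -- Hensel lifting: if u is a unit mod D, the congruence u·s + D·A·s² ≡ b
  -- is solvable modulo every power Dᵏ (the quadratic term vanishes mod D).
  hensel : ∀ {D u v w} → u * v + D * w ≡ + 1 →
           ∀ A b k → ∃ λ s → D ^ k ∣ u * s + D * A * s * s - b
  hensel {D} {u} _ A b zero = + 0 , divides (- b) (at-zero u D A b)
    where
    at-zero : ∀ u D A b → u * + 0 + D * A * + 0 * + 0 - b ≡ - b * + 1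
    at-zero = solve-∀
  hensel {D} {u} {v} {w} uv+Dw≡1 A b (suc k) with hensel {D} {u} {v} {w} uv+Dw≡1 A b k
  ... | s , divides δ fs≡δP = s + P * t , divides (δ * w + A * Q) (begin
    u * (s + P * t) + D * A * (s + P * t) * (s + P * t) - b
      ≡⟨ expand u s P t D A b ⟩
    (u * s + D * A * s * s - b) + P * (u * t) + D * P * (A * Q)
      ≡⟨ cong (λ x → x + P * (u * t) + D * P * (A * Q)) fs≡δP ⟩
    δ * P + P * (u * (- δ * v)) + D * P * (A * Q)
      ≡⟨ cong (_+ D * P * (A * Q)) (extract-δ δ P u v) ⟩
    P * δ * (+ 1 - u * v) + D * P * (A * Q)
      ≡⟨ cong (λ x → P * δ * x + D * P * (A * Q)) (unit-complement {u} {v} {D} {w} uv+Dw≡1) ⟩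
    P * δ * (D * w) + D * P * (A * Q)
      ≡⟨ collect P δ D w A Q ⟩
    (δ * w + A * Q) * (D * P)
      ∎)
    where
    P = D ^ k
    t = - δ * v
    Q = + 2 * s * t + P * t * t
    expand : ∀ u s P t D A b → u * (s + P * t) + D * A * (s + P * t) * (s + P * t) - b ≡
             (u * s + D * A * s * s - b) + P * (u * t) + D * P * (A * (+ 2 * s * t + P * t * t))
    expand = solve-∀
    extract-δ : ∀ δ P u v → δ * P + P * (u * (- δ * v)) ≡ P * δ * (+ 1 - u * v)
    extract-δ = solve-∀
    collect : ∀ P δ D w A Q → P * δ * (D * w) + D * P * (A * Q) ≡ (δ * w + A * Q) * (D * P)
    collect = solve-∀

  ℕ-identity : ∀ {a b c d} → 1 ℕ.+ a ℕ.* b ≡ c ℕ.* d → + c * + d - + a * + b ≡ + 1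
  ℕ-identity {a} {b} {c} {d} eq = begin
    + c * + d - + a * + b               ≡⟨ cong (_- + a * + b) (pos-* c d) ⟨
    + (c ℕ.* d) - + a * + b             ≡⟨ cong (λ n → + n - + a * + b) eq ⟨
    + (1 ℕ.+ a ℕ.* b) - + a * + b       ≡⟨ cong (_- + a * + b) (trans (pos-+ 1 (a ℕ.* b)) (cong (λ n → + 1 + n) (pos-* a b))) ⟩
    + 1 + + a * + b - + a * + b         ≡⟨ cancel (+ a * + b) ⟩
    + 1                                 ∎
    where
    cancel : ∀ x → + 1 + x - x ≡ + 1
    cancel = solve-∀

  bézout-ℤ : ∀ {m n} → Bézout.Identity 1 m n → ∃₂ λ v w → + m * v + + n * w ≡ + 1
  bézout-ℤ {m} {n} (Bézout.+- x y eq) =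
    + x , - + y , trans (rearrange (+ m) (+ x) (+ n) (+ y)) (ℕ-identity {y} {n} {x} {m} eq)
    where
    rearrange : ∀ m x n y → m * x + n * - y ≡ x * m - y * n
    rearrange = solve-∀
  bézout-ℤ {m} {n} (Bézout.-+ x y eq) =
    - + x , + y , trans (rearrange (+ m) (+ x) (+ n) (+ y)) (ℕ-identity {x} {m} {y} {n} eq)
    where
    rearrange : ∀ m x n y → m * - x + n * y ≡ y * n - x * m
    rearrange = solve-∀

  -- The dichotomy driving the induction: a is a unit modulo e+1, or a and
  -- e+1 share a factor g+2 ≥ 2.
  data UnitOrFactorℕ (a e : ℕ) : Set where
    unit   : ∀ v w → + a * v + + suc e * w ≡ + 1 → UnitOrFactorℕ a e
    factor : ∀ g q e′ → a ≡ suc (suc g) ℕ.* q → suc e ≡ suc (suc g) ℕ.* suc e′ →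
             UnitOrFactorℕ a e

  unitOrFactorℕ : ∀ a e → UnitOrFactorℕ a e
  unitOrFactorℕ a e with Bézout.lemma a (suc e)
  ... | Bézout.result 0 gcd _ = ⊥-elim (ℕ.1+n≢0 (0∣⇒≡0 (proj₂ (GCD.commonDivisor gcd))))
  ... | Bézout.result 1 _ identity with bézout-ℤ identity
  ...   | v , w , eq = unit v w eq
  unitOrFactorℕ a e | Bézout.result (suc (suc g)) gcd _ with GCD.commonDivisor gcd
  ... | divides q a≡qG , divides (suc e′) D≡e′G =
    factor g q e′ (trans a≡qG (ℕ.*-comm q _)) (trans D≡e′G (ℕ.*-comm (suc e′) _))

  data UnitOrFactor (y : ℤ) (e : ℕ) : Set where
    unit   : ∀ v w → y * v + + suc e * w ≡ + 1 → UnitOrFactor y e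
    factor : ∀ g e′ y′ → y ≡ + suc (suc g) * y′ → suc e ≡ suc (suc g) ℕ.* suc e′ →
             UnitOrFactor y e

  unitOrFactor : ∀ y e → UnitOrFactor y e
  unitOrFactor (+ a) e with unitOrFactorℕ a e
  ... | unit v w eq           = unit v w eq
  ... | factor g q e′ a≡ D≡   = factor g e′ (+ q) (trans (cong +_ a≡) (pos-* (suc (suc g)) q)) D≡
  unitOrFactor -[1+ a ] e with unitOrFactorℕ (suc a) e
  ... | unit v w eq           = unit (- v) w (trans (cong (_+ + suc e * w) (neg-cancel (+ suc a) v)) eq)
    where
    neg-cancel : ∀ a v → - a * - v ≡ a * v
    neg-cancel = solve-∀
  ... | factor g q e′ a≡ D≡   =
    factor g e′ (- + q) (trans (cong (λ n → - + n) a≡) (trans (cong -_ (pos-* (suc (suc g)) q))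
                                                             (neg-distribʳ-* (+ suc (suc g)) (+ q)))) D≡

  cofactor-< : ∀ g {m n} → suc n ≡ suc (suc g) ℕ.* suc m → m ℕ.< n
  cofactor-< g {m} eq = ℕ.s<s⁻¹ (subst (suc m ℕ.<_)
    (sym (trans eq (ℕ.*-comm (suc (suc g)) (suc m))))
    (ℕ.m<m*n (suc m) (suc (suc g)) (s≤s (s≤s z≤n))))

  ℤ-factor : ∀ {m} n k → m ≡ n ℕ.* k → + m ≡ + n * + k
  ℤ-factor n k eq = trans (cong +_ eq) (pos-* n k)

  record Reachable (e : ℕ) (E y : ℤ) : Set where
    constructor reach
    field
      b     : ℤ
      k     : ℕ
      lands : + suc e ∣ Tᵏ e k (y + + suc e * (E * b))

  -- If E is a unit mod D, one step suffices: choose b with ⌈z/D⌉ ≡ 0 (mod D).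
  reachable-unit : ∀ e {E} y v w → E * v + + suc e * w ≡ + 1 → Reachable e E y
  reachable-unit e {E} y v w Ev+Dw≡1 = reach b 1 (divides (z * c * w) (begin
    z * (z ⌈/ℕ⌉ suc e)    ≡⟨ cong (z *_) (⌈⌉-shift y (E * b)) ⟩
    z * (c + E * b)       ≡⟨ extract-c z c E v ⟩
    z * c * (+ 1 - E * v) ≡⟨ cong (z * c *_) (unit-complement {E} {v} {D} {w} Ev+Dw≡1) ⟩
    z * c * (D * w)       ≡⟨ regroup z c D w ⟩
    z * c * w * D         ∎))
    where
    D = + suc e
    c = y ⌈/ℕ⌉ suc e
    b = - (c * v)
    z = y + D * (E * b)
    extract-c : ∀ z c E v → z * (c + E * - (c * v)) ≡ z * c * (+ 1 - E * v)
    extract-c = solve-∀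
    regroup : ∀ z c D w → z * c * (D * w) ≡ z * c * w * D
    regroup = solve-∀

  reachable-scaled : ∀ g {e e′ E y y′} → + suc e ≡ + suc (suc g) * + suc e′ →
                     y ≡ + suc (suc g) * y′ → Reachable e′ E y′ → Reachable e E y
  reachable-scaled g {e} {e′} {E} {y} {y′} D≡GD′ y≡Gy′ (reach b k (divides j Tᵏ≡jD′)) =
    reach b k (divides j (begin
      Tᵏ e k (y + D * (E * b))          ≡⟨ cong (Tᵏ e k) factored ⟩
      Tᵏ e k (G * (y′ + D′ * (E * b)))  ≡⟨ Tᵏ-scale (suc g) D≡GD′ k _ ⟩
      G * Tᵏ e′ k (y′ + D′ * (E * b))   ≡⟨ cong (G *_) Tᵏ≡jD′ ⟩
      G * (j * D′)                      ≡⟨ swap G j D′ ⟩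
      j * (G * D′)                      ≡⟨ cong (j *_) D≡GD′ ⟨
      j * D                             ∎))
    where
    D = + suc e
    D′ = + suc e′
    G = + suc (suc g)
    swap : ∀ G j D′ → G * (j * D′) ≡ j * (G * D′)
    swap = solve-∀
    factored : y + D * (E * b) ≡ G * (y′ + D′ * (E * b))
    factored = trans (cong₂ (λ y D → y + D * (E * b)) y≡Gy′ D≡GD′) (distrib G y′ D′ (E * b))
      where
      distrib : ∀ G y′ D′ x → G * y′ + G * D′ * x ≡ G * (y′ + D′ * x)
      distrib = solve-∀

  -- Taking b = D′·s, one
  -- step of T gives T y + D·F·(u·s + D·(D·F)·s²) with u = y + D·⌈y/D⌉ a unit
  -- mod D; Hensel lifting makes this ≡ T y + D·F·b₁ (mod Dᵏ⁺¹), and the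
  -- congruence lemma transports the reachability of the latter.
  reachable-lift : ∀ g {e e′ E F y v w} → y * v + + suc e * w ≡ + 1 →
                   E ≡ + suc (suc g) * F → + suc e ≡ + suc (suc g) * + suc e′ →
                   Reachable e F (T e y) → Reachable e E y
  reachable-lift g {e} {e′} {E} {F} {y} {v} {w} yv+Dw≡1 E≡GF D≡GD′ (reach b₁ k D∣Tᵏ) =
    lift (hensel {D} {u} {v} {w - c * v} u-unit (D * F) b₁ k)
    where
    D  = + suc e
    D′ = + suc e′
    G  = + suc (suc g)
    c  = y ⌈/ℕ⌉ suc e
    u  = y + D * c
    u-unit : u * v + D * (w - c * v) ≡ + 1
    u-unit = trans (regroup y D c v w) yv+Dw≡1
      where
      regroup : ∀ y D c v w → (y + D * c) * v + D * (w - c * v) ≡ y * v + D * w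
      regroup = solve-∀
    lift : ∃ (λ s → D ^ k ∣ u * s + D * (D * F) * s * s - b₁) → Reachable e E y
    lift (s , divides j hensel-eq) =
      reach (D′ * s) (suc k) (∣-transfer (Tᵏ-congruence e k D (divides (F * j) first-step)) D∣Tᵏ)
      where
      x = D * F * s
      start≡ : y + D * (E * (D′ * s)) ≡ y + D * x
      start≡ = begin
        y + D * (E * (D′ * s))        ≡⟨ cong (λ E → y + D * (E * (D′ * s))) E≡GF ⟩
        y + D * (G * F * (D′ * s))    ≡⟨ regroup y D G F D′ s ⟩
        y + D * (G * D′ * F * s)      ≡⟨ cong (λ D₀ → y + D * (D₀ * F * s)) D≡GD′ ⟨
        y + D * x                     ∎
        where
        regroup : ∀ y D G F D′ s → y + D * (G * F * (D′ * s)) ≡ y + D * (G * D′ * F * s)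
        regroup = solve-∀
      first-step : T e (y + D * (E * (D′ * s))) - (T e y + D * (F * b₁)) ≡ F * j * (D ^ k * D)
      first-step = begin
        T e (y + D * (E * (D′ * s))) - (T e y + D * (F * b₁))
          ≡⟨ cong (λ z → T e z - (T e y + D * (F * b₁))) start≡ ⟩
        T e (y + D * x) - (T e y + D * (F * b₁))
          ≡⟨ cong (_- (T e y + D * (F * b₁))) (T-shift e y x) ⟩
        T e y + x * (y + D * (c + x)) - (T e y + D * (F * b₁))
          ≡⟨ regroup (T e y) y D c F s b₁ ⟩
        D * F * (u * s + D * (D * F) * s * s - b₁)
          ≡⟨ cong (D * F *_) hensel-eq ⟩
        D * F * (j * D ^ k)
          ≡⟨ rearrange D F j (D ^ k) ⟩
        F * j * (D ^ k * D)
          ∎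
        where
        regroup : ∀ t y D c F s b₁ →
                  t + D * F * s * (y + D * (c + D * F * s)) - (t + D * (F * b₁)) ≡
                  D * F * ((y + D * c) * s + D * (D * F) * s * s - b₁)
        regroup = solve-∀
        rearrange : ∀ D F j P → D * F * (j * P) ≡ F * j * (P * D)
        rearrange = solve-∀

  reachable : ∀ e E y → Reachable e (+ suc E) y
  reachable = <-rec (λ e → ∀ E y → Reachable e (+ suc E) y) reachable-at
    where
    reachable-at : ∀ e → (∀ {e′} → e′ ℕ.< e → ∀ E y → Reachable e′ (+ suc E) y) →
                   ∀ E y → Reachable e (+ suc E) y
    reachable-at e smaller-D = <-rec (λ E → ∀ y → Reachable e (+ suc E) y) step
      where
      step : ∀ E → (∀ {F} → F ℕ.< E → ∀ y → Reachable e (+ suc F) y) →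
             ∀ y → Reachable e (+ suc E) y
      step E smaller-E y with unitOrFactor y e
      ... | factor g e′ y′ y≡Gy′ D≡GD′ =
        reachable-scaled g (ℤ-factor (suc (suc g)) (suc e′) D≡GD′) y≡Gy′
          (smaller-D (cofactor-< g D≡GD′) E y′)
      ... | unit _ _ y-unit with unitOrFactorℕ (suc E) e
      ...   | unit v w E-unit = reachable-unit e y v w E-unit
      ...   | factor g zero _ E≡G*0 _ = ⊥-elim (ℕ.1+n≢0 (trans E≡G*0 (ℕ.*-zeroʳ (suc (suc g)))))
      ...   | factor g (suc F) e′ E≡GF D≡GD′ =
        reachable-lift g y-unit (ℤ-factor (suc (suc g)) (suc F) E≡GF)
          (ℤ-factor (suc (suc g)) (suc e′) D≡GD′) (smaller-E (cofactor-< g E≡GF) (T e y))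

  reachable-neg : ∀ {e E y} → Reachable e E y → Reachable e (- E) y
  reachable-neg {e} {E} {y} (reach b k D∣Tᵏ) =
    reach (- b) k (subst (λ x → + suc e ∣ Tᵏ e k (y + + suc e * x)) (double-neg E b) D∣Tᵏ)
    where
    double-neg : ∀ E b → E * b ≡ - E * - b
    double-neg = solve-∀

  reachable-nonzero : ∀ e {E} y → E ≢ + 0 → Reachable e E y
  reachable-nonzero e {+ zero}   y E≢0 = ⊥-elim (E≢0 refl)
  reachable-nonzero e {+ suc E}  y _   = reachable e E y
  reachable-nonzero e { -[1+ E ]} y _  = reachable-neg (reachable e E y)

  power-positive : ∀ e k → ∃ λ N → (+ suc e) ^ k ≡ + suc N
  power-positive e zero = 0 , refl
  power-positive e (suc k) with power-positive e k
  ... | N , Dᵏ≡ = N ℕ.+ e ℕ.* suc N ,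
                  trans (cong (+ suc e *_) Dᵏ≡) (sym (pos-* (suc e) (suc N)))

  positive-representative : ∀ b N → ∃₂ λ i t → b + + suc N * i ≡ + suc t
  positive-representative (+ m) N = + 1 , m ℕ.+ N , (begin
    + m + + suc N * + 1   ≡⟨ cong (λ n → + m + n) (*-identityʳ (+ suc N)) ⟩
    + m + + suc N         ≡⟨ pos-+ m (suc N) ⟨
    + (m ℕ.+ suc N)       ≡⟨ cong +_ (ℕ.+-suc m N) ⟩
    + suc (m ℕ.+ N)       ∎)
  positive-representative -[1+ m ] N = + suc (suc m) , N ℕ.* suc (suc m) , (begin
    -[1+ m ] + + suc N * + suc (suc m)    ≡⟨ simplify (+ m) (+ N) ⟩
    + 1 + + N * + suc (suc m)             ≡⟨ cong (λ n → + 1 + n) (pos-* N (suc (suc m))) ⟨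
    + suc (N ℕ.* suc (suc m))             ∎)
    where
    simplify : ∀ m N → - (+ 1 + m) + (+ 1 + N) * (+ 1 + (+ 1 + m)) ≡ + 1 + N * (+ 1 + (+ 1 + m))
    simplify = solve-∀

  -- Tᵏ is periodic modulo D with period Dᵏ⁺¹ (Tᵏ-congruence), so the
  -- parameter b of a reachable point may be replaced by a positive one.
  reachable-positive : ∀ {e E y} → Reachable e E y →
                       ∃₂ λ t k → + suc e ∣ Tᵏ e k (y + + suc e * (E * + suc t))
  reachable-positive {e} {E} {y} (reach b k D∣Tᵏ) with power-positive e k
  ... | N , Dᵏ≡ with positive-representative b N
  ...   | i , t , b+Dᵏi≡ =
    t , k , ∣-transfer (Tᵏ-congruence e k D (divides (E * i) shift)) D∣Tᵏ
    where
    D = + suc e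
    shift : y + D * (E * + suc t) - (y + D * (E * b)) ≡ E * i * (D ^ k * D)
    shift = begin
      y + D * (E * + suc t) - (y + D * (E * b))
        ≡⟨ cong (λ x → y + D * (E * x) - (y + D * (E * b))) b+Dᵏi≡ ⟨
      y + D * (E * (b + + suc N * i)) - (y + D * (E * b))
        ≡⟨ cong (λ P → y + D * (E * (b + P * i)) - (y + D * (E * b))) Dᵏ≡ ⟨
      y + D * (E * (b + D ^ k * i)) - (y + D * (E * b))
        ≡⟨ cancel y D E b (D ^ k) i ⟩
      E * i * (D ^ k * D)
        ∎
      where
      cancel : ∀ y D E b P i → y + D * (E * (b + P * i)) - (y + D * (E * b)) ≡ E * i * (P * D)
      cancel = solve-∀

module RationalBridge where

  open import Data.Nat as ℕ using (ℕ; zero; suc)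
  import Data.Nat.Properties as ℕ
  open import Data.Integer as ℤ using (ℤ; +_; _/ℕ_)
  open import Data.Integer.Properties using (pos-*; *-identityʳ)
  open import Data.Integer.DivMod using (div-pos-is-/ℕ)
  open import Data.Integer.Divisibility.Signed using (_∣_; divides)
  open import Data.Integer.Tactic.RingSolver using (solve-∀)
  open import Data.Rational as ℚ using (ℚ; mkℚ; floor; ceiling; toℚᵘ)
  open import Data.Rational.Properties
    using (toℚᵘ-fromℚᵘ; toℚᵘ-injective; fromℚᵘ-cong; toℚᵘ-homo-*; toℚᵘ-homo-+; toℚᵘ-homo‿-)
  open import Data.Rational.Unnormalised as ℚᵘ using (mkℚᵘ; *≡*)
  import Data.Rational.Unnormalised.Properties as ℚᵘ
  open import Data.Product using (_,_)
  open import Relation.Binary.PropositionalEquality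
  open ≡-Reasoning
  open IntegerDynamics using (_⌈/ℕ⌉_; /ℕ-cross; T; Tᵏ)

  toℚᵘ-/ : ∀ z e → toℚᵘ (z ℚ./ suc e) ℚᵘ.≃ mkℚᵘ z e
  toℚᵘ-/ z e = toℚᵘ-fromℚᵘ (mkℚᵘ z e)

  floor-/ : ∀ w e → floor (w ℚ./ suc e) ≡ w /ℕ suc e
  floor-/ w e = floor-≃ (w ℚ./ suc e) (toℚᵘ-/ w e)
    where
    floor-≃ : ∀ q → toℚᵘ q ℚᵘ.≃ mkℚᵘ w e → floor q ≡ w /ℕ suc e
    floor-≃ (mkℚ n d _) (*≡* cross) = trans (div-pos-is-/ℕ n (suc d)) (/ℕ-cross {n} {w} {d} {e} cross)

  ceiling-via-floor : ∀ q → ceiling q ≡ ℤ.- floor (ℚ.- q)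
  ceiling-via-floor (mkℚ _ _ _) = refl

  neg-/ : ∀ z e → ℚ.- (z ℚ./ suc e) ≡ (ℤ.- z) ℚ./ suc e
  neg-/ z e = toℚᵘ-injective (ℚᵘ.≃-trans (toℚᵘ-homo‿- (z ℚ./ suc e))
    (ℚᵘ.≃-trans (ℚᵘ.-‿cong (toℚᵘ-/ z e)) (ℚᵘ.≃-sym (toℚᵘ-/ (ℤ.- z) e))))

  ceiling-/ : ∀ z e → ceiling (z ℚ./ suc e) ≡ z ⌈/ℕ⌉ suc e
  ceiling-/ z e = begin
    ceiling (z ℚ./ suc e)                 ≡⟨ ceiling-via-floor (z ℚ./ suc e) ⟩
    ℤ.- floor (ℚ.- (z ℚ./ suc e))         ≡⟨ cong (λ q → ℤ.- floor q) (neg-/ z e) ⟩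
    ℤ.- floor ((ℤ.- z) ℚ./ suc e)         ≡⟨ cong ℤ.-_ (floor-/ (ℤ.- z) e) ⟩
    z ⌈/ℕ⌉ suc e                        ∎

  *-/ : ∀ z c e → (z ℚ./ suc e) ℚ.* (c ℚ./ 1) ≡ (z ℤ.* c) ℚ./ suc e
  *-/ z c e = toℚᵘ-injective (ℚᵘ.≃-trans (toℚᵘ-homo-* (z ℚ./ suc e) (c ℚ./ 1))
    (ℚᵘ.≃-trans (ℚᵘ.*-cong (toℚᵘ-/ z e) (toℚᵘ-/ c 0))
      (ℚᵘ.≃-trans (*≡* (cong (λ n → (z ℤ.* c) ℤ.* + n) (sym (ℕ.*-identityʳ (suc e)))))
        (ℚᵘ.≃-sym (toℚᵘ-/ (z ℤ.* c) e)))))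

  χ-/ : ∀ z e → χ (z ℚ./ suc e) ≡ T e z ℚ./ suc e
  χ-/ z e = trans (cong (λ c → (z ℚ./ suc e) ℚ.* (c ℚ./ 1)) (ceiling-/ z e)) (*-/ z _ e)

  χ^-suc : ∀ k x → χ^ (suc k) x ≡ χ^ k (χ x)
  χ^-suc zero    x = refl
  χ^-suc (suc k) x = cong χ (χ^-suc k x)

  χ^-/ : ∀ k z e → χ^ k (z ℚ./ suc e) ≡ Tᵏ e k z ℚ./ suc e
  χ^-/ zero    z e = refl
  χ^-/ (suc k) z e = begin
    χ^ (suc k) (z ℚ./ suc e)   ≡⟨ χ^-suc k (z ℚ./ suc e) ⟩
    χ^ k (χ (z ℚ./ suc e))     ≡⟨ cong (χ^ k) (χ-/ z e) ⟩
    χ^ k (T e z ℚ./ suc e)     ≡⟨ χ^-/ k (T e z) e ⟩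
    Tᵏ e (suc k) z ℚ./ suc e   ∎

  finite-order : ∀ {e k z} → + suc e ∣ Tᵏ e k z → FiniteOrd (z ℚ./ suc e)
  finite-order {e} {k} {z} (divides j Tᵏz≡jD) =
    k , j , trans (χ^-/ k z e) (fromℚᵘ-cong {mkℚᵘ (Tᵏ e k z) e} {mkℚᵘ j 0} (*≡* (trans (*-identityʳ (Tᵏ e k z)) Tᵏz≡jD)))

  progression-term : ∀ y e p q n →
    (y ℚ./ suc e) ℚ.+ (+ (suc q ℕ.* n) ℚ./ 1) ℚ.* (p ℚ./ suc q) ≡
    (y ℤ.+ + suc e ℤ.* (p ℤ.* + n)) ℚ./ suc e
  progression-term y e p q n = toℚᵘ-injective (ℚᵘ.≃-trans
    (toℚᵘ-homo-+ (y ℚ./ suc e) ((+ N ℚ./ 1) ℚ.* (p ℚ./ suc q)))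
    (ℚᵘ.≃-trans (ℚᵘ.+-cong (toℚᵘ-/ y e) (ℚᵘ.≃-trans (toℚᵘ-homo-* (+ N ℚ./ 1) (p ℚ./ suc q))
                                                    (ℚᵘ.*-cong (toℚᵘ-/ (+ N) 0) (toℚᵘ-/ p q))))
      (ℚᵘ.≃-trans (*≡* cross) (ℚᵘ.≃-sym (toℚᵘ-/ (y ℤ.+ D ℤ.* (p ℤ.* + n)) e)))))
    where
    N = suc q ℕ.* n
    D = + suc e
    Q = + suc q
    cross : (y ℤ.* + (1 ℕ.* suc q) ℤ.+ + N ℤ.* p ℤ.* D) ℤ.* D ≡
            (y ℤ.+ D ℤ.* (p ℤ.* + n)) ℤ.* + (suc e ℕ.* (1 ℕ.* suc q))
    cross = begin
      (y ℤ.* + (1 ℕ.* suc q) ℤ.+ + N ℤ.* p ℤ.* D) ℤ.* D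
        ≡⟨ cong₂ (λ a b → (y ℤ.* a ℤ.+ b ℤ.* p ℤ.* D) ℤ.* D) 1*Q (pos-* (suc q) n) ⟩
      (y ℤ.* Q ℤ.+ Q ℤ.* + n ℤ.* p ℤ.* D) ℤ.* D
        ≡⟨ regroup y Q (+ n) p D ⟩
      (y ℤ.+ D ℤ.* (p ℤ.* + n)) ℤ.* (D ℤ.* Q)
        ≡⟨ cong ((y ℤ.+ D ℤ.* (p ℤ.* + n)) ℤ.*_) (trans (pos-* (suc e) (1 ℕ.* suc q)) (cong (D ℤ.*_) 1*Q)) ⟨
      (y ℤ.+ D ℤ.* (p ℤ.* + n)) ℤ.* + (suc e ℕ.* (1 ℕ.* suc q))
        ∎
      where
      1*Q : + (1 ℕ.* suc q) ≡ Q
      1*Q = cong +_ (ℕ.*-identityˡ (suc q))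
      regroup : ∀ y Q n p D → (y ℤ.* Q ℤ.+ Q ℤ.* n ℤ.* p ℤ.* D) ℤ.* D ≡ (y ℤ.+ D ℤ.* (p ℤ.* n)) ℤ.* (D ℤ.* Q)
      regroup = solve-∀

open import Data.Nat using (ℕ; suc)
open import Data.Integer using (+_)
open import Data.Product using (∃)
open import Relation.Nullary using (¬_)
open import Relation.Binary.PropositionalEquality using (_≡_)
open import Data.Rational using (ℚ; _+_; _*_; _/_; 0ℚ)

open import Data.Nat as ℕ using ()
open import Data.Integer as ℤ using ()
open import Data.Product using (_,_)
open import Data.Rational using (mkℚ)
open import Data.Rational.Properties using (↥p≡0⇒p≡0; ↥p/↧p≡p)
open import Relation.Binary.PropositionalEquality using (_≢_; sym; trans; cong₂; subst)
open IntegerDynamics using (reachable-nonzero; reachable-positive)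
open RationalBridge using (finite-order; progression-term)

corollary3p3 : (u r : ℚ) → ¬ (r ≡ 0ℚ) → ∃ λ (m : ℕ) → FiniteOrd (u + ((+ (suc m)) / 1) * r)
corollary3p3 u@(mkℚ y e _) r@(mkℚ p q _) r≢0
  with reachable-positive (reachable-nonzero e y p≢0)
  where
  p≢0 : p ≢ + 0
  p≢0 p≡0 = r≢0 (↥p≡0⇒p≡0 r p≡0)
... | t , k , D∣Tᵏ = t ℕ.+ q ℕ.* suc t , subst FiniteOrd (sym term≡) (finite-order {e} {k} D∣Tᵏ)
  where
  -- with m + 1 = (q+1)(t+1), the term u + (m+1)·r is (y + D·p·(t+1)) / D
  term≡ : u + (+ (suc q ℕ.* suc t) / 1) * r ≡ (y ℤ.+ + suc e ℤ.* (p ℤ.* + suc t)) / suc e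
  term≡ = trans (cong₂ (λ u r → u + (+ (suc q ℕ.* suc t) / 1) * r) (sym (↥p/↧p≡p u)) (sym (↥p/↧p≡p r)))
                (progression-term y e p q (suc t))
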